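{- Let $M,N$ be $\lambda\mu$-terms with $M\in\mathcal{NF}_{\beta\mu\mu'\rho\varepsilon}$ and $M\twoheadrightarrow_\theta N$. Then $N\in\mathcal{NF}_{\beta\mu\mu'\rho\varepsilon}$; moreover, if $N$ is of the form $\lambda x.N'$ then $M$ is of the form $\lambda x.M'$ or $\mu\alpha.M'$, and if $N$ is of the form $\mu\alpha.N'$ then $M$ is of the form $\mu\beta.M'$.
   Context: $\lambda\mu$-terms: $\mathcal{T} ::= x \mid \lambda x.\mathcal{T} \mid (\mathcal{T})\mathcal{T} \mid [\alpha]\mathcal{T} \mid \mu\alpha.\mathcal{T}$ ($x$ $\lambda$-variables, $\alpha$ $\mu$-variables), up to renaming of bound variables. Redexes: $\beta$: $(\lambda x.M)N$; $\mu$: $(\mu\alpha.M)N$; $\mu'$: $(N)\mu\alpha.M$; $\rho$: $[\beta]\mu\alpha.M$; $\varepsilon$: $\mu\alpha.\mu\beta.M$; $\theta$: $\mu\alpha.[\alpha]M$ with $\alpha$ not free in $M$, whose contraction is $\mu\alpha.[\alpha]M\to_\theta M$. $\twoheadrightarrow_\theta$ is the reflexive-transitive closure of contracting one $\theta$-redex anywhere in a term. $\mathcal{NF}_{\beta\mu\mu'\rho\varepsilon}$ is the set of terms containing no $\beta$-, $\mu$-, $\mu'$-, $\rho$- or $\varepsilon$-redex as a subterm. -}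

module Defs where

open import Data.Nat using (ℕ; zero; suc; _<ᵇ_)
open import Data.Bool using (if_then_else_)
open import Data.Product using (∃; _,_)
open import Data.Empty using (⊥)
open import Relation.Nullary using (¬_)
open import Relation.Binary.PropositionalEquality using (_≡_)
open import Relation.Binary.Construct.Closure.ReflexiveTransitive using (Star)

-- λμ-terms up to α-renaming, via de Bruijn indices.
-- λ-variables and μ-variables live in separate index spaces:
--   var i    : λ-variable with index i (bound by `lam`)
--   lam M    : λx.M   (binds λ-index 0 in M)
--   app M N  : (M)N
--   name a M : [α]M   (α is the μ-variable with index a)
--   mu M     : μα.M   (binds μ-index 0 in M)
data Term : Set where
  var  : ℕ → Term
  lam  : Term → Term
  app  : Term → Term → Term
  name : ℕ → Term → Term
  mu   : Term → Term

shiftμ : ℕ → Term → Term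
shiftμ c (var i)    = var i
shiftμ c (lam M)    = lam (shiftμ c M)
shiftμ c (app M N)  = app (shiftμ c M) (shiftμ c N)
shiftμ c (name a M) = name (if a <ᵇ c then a else suc a) (shiftμ c M)
shiftμ c (mu M)     = mu (shiftμ (suc c) M)

data Redex : Term → Set where
  β  : ∀ M N → Redex (app (lam M) N)
  μr : ∀ M N → Redex (app (mu M) N)
  μ' : ∀ N M → Redex (app N (mu M))
  ρ  : ∀ b M → Redex (name b (mu M))
  ε  : ∀ M → Redex (mu (mu M))

data _⊑_ : Term → Term → Set where
  here  : ∀ {M} → M ⊑ M
  inLam : ∀ {S M} → S ⊑ M → S ⊑ lam M
  inAppˡ : ∀ {S M N} → S ⊑ M → S ⊑ app M N
  inAppʳ : ∀ {S M N} → S ⊑ N → S ⊑ app M N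
  inName : ∀ {S a M} → S ⊑ M → S ⊑ name a M
  inMu  : ∀ {S M} → S ⊑ M → S ⊑ mu M

NF : Term → Set
NF M = ∀ S → S ⊑ M → ¬ Redex S

-- one θ-step anywhere: μα.[α]M → M with α not free in M.
-- In de Bruijn form "α not free in M" means the body of [α] is shiftμ 0 M'
-- for the (unique) M' obtained by lowering, and the contractum is M'.
data _→θ_ : Term → Term → Set where
  θ     : ∀ M → mu (name 0 (shiftμ 0 M)) →θ M
  cLam  : ∀ {M M'} → M →θ M' → lam M →θ lam M'
  cAppˡ : ∀ {M M' N} → M →θ M' → app M N →θ app M' N
  cAppʳ : ∀ {M N N'} → N →θ N' → app M N →θ app M N'
  cName : ∀ {a M M'} → M →θ M' → name a M →θ name a M'
  cMu   : ∀ {M M'} → M →θ M' → mu M →θ mu M'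

_↠θ_ : Term → Term → Set
_↠θ_ = Star _→θ_

-- Contracting μα.[α]M to M cannot create a redex inside M: M is, up to renaming of
-- μ-variables, a subterm of the original term, and renaming preserves redexes. The only
-- other place a new redex could appear is the term immediately enclosing the contracted
-- position, and there it is ruled out because a θ-step producing a λ- or μ-abstraction
-- starts from a λ- or μ-abstraction, so a redex of the same kind was already present.
-- Iterating this shape reflection along the reduction gives the claims about the head of M.
module Submission where

open import Defs
open import Data.Nat using (suc)
open import Data.Product using (∃; _×_; _,_)
open import Data.Sum using (_⊎_; inj₁; inj₂)
open import Function using (_∘_; id)
open import Relation.Nullary using (¬_)
open import Relation.Binary.PropositionalEquality using (_≡_; refl)
open import Relation.Binary.Construct.Closure.ReflexiveTransitive using (fold)

IsLam : Term → Set
IsLam M = ∃ λ M' → M ≡ lam M'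

IsMu : Term → Set
IsMu M = ∃ λ M' → M ≡ mu M'

IsAbstraction : Term → Set
IsAbstraction M = IsLam M ⊎ IsMu M

Redex-shiftμ : ∀ c {S} → Redex S → Redex (shiftμ c S)
Redex-shiftμ c (β M N)     = β _ _
Redex-shiftμ c (μr M N)    = μr _ _
Redex-shiftμ c (μ' N M)    = μ' _ _
Redex-shiftμ c (ρ b M)     = ρ _ _
Redex-shiftμ c (Redex.ε M) = Redex.ε _

⊑-shiftμ : ∀ c {S M} → S ⊑ M → ∃ λ c' → shiftμ c' S ⊑ shiftμ c M
⊑-shiftμ c here       = c , here
⊑-shiftμ c (inLam p)  with ⊑-shiftμ c p
... | c' , q = c' , inLam q
⊑-shiftμ c (inAppˡ p) with ⊑-shiftμ c p
... | c' , q = c' , inAppˡ q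
⊑-shiftμ c (inAppʳ p) with ⊑-shiftμ c p
... | c' , q = c' , inAppʳ q
⊑-shiftμ c (inName p) with ⊑-shiftμ c p
... | c' , q = c' , inName q
⊑-shiftμ c (inMu p)   with ⊑-shiftμ (suc c) p
... | c' , q = c' , inMu q

NF-unshiftμ : ∀ c M → NF (shiftμ c M) → NF M
NF-unshiftμ c M nf S p r with ⊑-shiftμ c p
... | c' , q = nf _ q (Redex-shiftμ c' r)

NF-⊑ : ∀ {M M'} → (∀ {S} → S ⊑ M → S ⊑ M') → NF M' → NF M
NF-⊑ embed nf S p = nf S (embed p)

→θ-reflects-IsMu : ∀ {M N} → M →θ N → IsMu N → IsMu M
→θ-reflects-IsMu (θ _)   (_ , refl) = _ , refl
→θ-reflects-IsMu (cMu _) (_ , refl) = _ , refl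

→θ-reflects-IsAbstraction : ∀ {M N} → M →θ N → IsAbstraction N → IsAbstraction M
→θ-reflects-IsAbstraction (θ _)    _                = inj₂ (_ , refl)
→θ-reflects-IsAbstraction (cLam _) (inj₁ (_ , refl)) = inj₁ (_ , refl)
→θ-reflects-IsAbstraction s        (inj₂ isMu)       = inj₂ (→θ-reflects-IsMu s isMu)

→θ-no-root-Redex : ∀ {M N} → NF M → M →θ N → ¬ Redex N
→θ-no-root-Redex nf (θ M) r = nf _ (inMu (inName here)) (Redex-shiftμ 0 r)
→θ-no-root-Redex nf (cLam s) ()
→θ-no-root-Redex nf (cAppˡ s) (β _ _) with →θ-reflects-IsAbstraction s (inj₁ (_ , refl))
... | inj₁ (_ , refl) = nf _ here (β _ _)
... | inj₂ (_ , refl) = nf _ here (μr _ _)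
→θ-no-root-Redex nf (cAppˡ s) (μr _ _) with →θ-reflects-IsMu s (_ , refl)
... | _ , refl = nf _ here (μr _ _)
→θ-no-root-Redex nf (cAppˡ s) (μ' _ _) = nf _ here (μ' _ _)
→θ-no-root-Redex nf (cAppʳ s) (β _ _)  = nf _ here (β _ _)
→θ-no-root-Redex nf (cAppʳ s) (μr _ _) = nf _ here (μr _ _)
→θ-no-root-Redex nf (cAppʳ s) (μ' _ _) with →θ-reflects-IsMu s (_ , refl)
... | _ , refl = nf _ here (μ' _ _)
→θ-no-root-Redex nf (cName s) (ρ _ _) with →θ-reflects-IsMu s (_ , refl)
... | _ , refl = nf _ here (ρ _ _)
→θ-no-root-Redex nf (cMu s) (Redex.ε _) with →θ-reflects-IsMu s (_ , refl)
... | _ , refl = nf _ here (Redex.ε _)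

NF-→θ : ∀ {M N} → M →θ N → NF M → NF N
NF-→θ s         nf S here       = →θ-no-root-Redex nf s
NF-→θ (θ M)     nf S p          = NF-unshiftμ 0 M (NF-⊑ (inMu ∘ inName) nf) S p
NF-→θ (cLam s)  nf S (inLam p)  = NF-→θ s (NF-⊑ inLam nf) S p
NF-→θ (cAppˡ s) nf S (inAppˡ p) = NF-→θ s (NF-⊑ inAppˡ nf) S p
NF-→θ (cAppˡ s) nf S (inAppʳ p) = nf S (inAppʳ p)
NF-→θ (cAppʳ s) nf S (inAppˡ p) = nf S (inAppˡ p)
NF-→θ (cAppʳ s) nf S (inAppʳ p) = NF-→θ s (NF-⊑ inAppʳ nf) S p
NF-→θ (cName s) nf S (inName p) = NF-→θ s (NF-⊑ inName nf) S p
NF-→θ (cMu s)   nf S (inMu p)   = NF-→θ s (NF-⊑ inMu nf) S p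

NF-↠θ : ∀ {M N} → M ↠θ N → NF M → NF N
NF-↠θ = fold (λ M N → NF M → NF N) (λ s k → k ∘ NF-→θ s) id

↠θ-reflects-IsMu : ∀ {M N} → M ↠θ N → IsMu N → IsMu M
↠θ-reflects-IsMu = fold (λ M N → IsMu N → IsMu M) (λ s k → →θ-reflects-IsMu s ∘ k) id

↠θ-reflects-IsAbstraction : ∀ {M N} → M ↠θ N → IsAbstraction N → IsAbstraction M
↠θ-reflects-IsAbstraction =
  fold (λ M N → IsAbstraction N → IsAbstraction M) (λ s k → →θ-reflects-IsAbstraction s ∘ k) id

lemma5p1 : ∀ (M N : Term) → NF M → M ↠θ N →
    NF N
    × (∀ N' → N ≡ lam N' → (∃ λ M' → M ≡ lam M') ⊎ (∃ λ M' → M ≡ mu M'))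
    × (∀ N' → N ≡ mu N' → ∃ λ M' → M ≡ mu M')
lemma5p1 M N nf steps =
    NF-↠θ steps nf
  , (λ N' N≡lam → ↠θ-reflects-IsAbstraction steps (inj₁ (N' , N≡lam)))
  , (λ N' N≡mu → ↠θ-reflects-IsMu steps (N' , N≡mu))
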